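{- For every integer $n\ge 1$ let $a_n$ be the smallest positive integer such that $n+a_n$ is prime. Then for every integer $a\ge 1$ the equation $a_n=a$ has infinitely many solutions $n$. -}

module Defs where

open import Data.Nat using (ℕ; _+_; _<_; _≤_; _≥_)
open import Data.Nat.Primality using (Prime)
open import Data.Product using (_×_)
open import Relation.Nullary using (¬_)

IsLeastPrimeGap : ℕ → ℕ → Set
IsLeastPrimeGap n a = (1 ≤ a) × Prime (n + a) × (∀ b → 1 ≤ b → b < a → ¬ Prime (n + b))

module Submission where

-- Idea: for K = M! the numbers K + 2, …, K + M are all composite, since
-- j ∣ K + j for 2 ≤ j ≤ M.  Take q to be the FIRST prime ≥ K + 2; it lies
-- beyond that composite run, so q ≥ K + M + 1.  Put n = q - a.  Then
-- n + a = q is prime while every n + b with 1 ≤ b < a lies in [K + 2, q)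
-- and so is not prime: a_n = a.  Choosing M = m + a + 1 makes n ≥ m.

open import Defs
open import Data.Nat using (ℕ; _≤_; _≥_)
open import Data.Product using (∃-syntax; _×_)

open import Data.Nat.Base using (suc; _+_; _∸_; _<_; _!; z≤n; s≤s; n>1⇒nonTrivial; nonTrivial⇒n>1)
open import Data.Nat.Properties
open import Data.Nat.Divisibility
  using (_∣_; _∣?_; ∣-refl; ∣-trans; ∣⇒≤; hasNonTrivialDivisor; m∣m*n; ∣m∣n⇒∣m+n; ∣m+n∣m⇒∣n; ∣1⇒≡1; m≤n⇒m!∣n!)
open import Data.Nat.Primality
  using (Prime; prime?; composite⇒¬prime; rough∧∣⇒prime; _Rough_)
open import Data.Product using (_,_)
open import Data.Sum using (inj₁; inj₂)
open import Relation.Nullary using (¬_; yes; no)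
open import Relation.Nullary.Negation using (contradiction)
open import Relation.Unary using (Pred; Decidable)
open import Relation.Binary.PropositionalEquality using (refl; subst; sym)

record FirstFrom {p} (P : Pred ℕ p) (L x : ℕ) : Set p where
  field
    from   : L ≤ x
    holds  : P x
    before : ∀ z → L ≤ z → z < x → ¬ P z

firstFrom : ∀ {p} {P : Pred ℕ p} → Decidable P → ∀ {L y} → L ≤ y → P y → ∃[ x ] FirstFrom P L x
firstFrom {P = P} P? {L} L≤y py with m≤n⇒∃[o]m+o≡n L≤y
... | k , refl = search L k py
  where
  search : ∀ L k → P (L + k) → ∃[ x ] FirstFrom P L x
  search L k pk with P? L
  search L k       pk | yes pL = L , record { from = ≤-refl ; holds = pL ; before = λ z L≤z z<L → contradiction L≤z (<⇒≱ z<L) }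
  search L 0       pk | no ¬pL = contradiction (subst P (+-identityʳ L) pk) ¬pL
  search L (suc k) pk | no ¬pL with search (suc L) k (subst P (+-suc L k) pk)
  ... | x , first = x , record { from = ≤-trans (n≤1+n L) from ; holds = holds ; before = before′ }
    where
    open FirstFrom first
    before′ : ∀ z → L ≤ z → z < x → ¬ P z
    before′ z L≤z z<x with m≤n⇒m<n∨m≡n L≤z
    ... | inj₁ L<z  = before z L<z z<x
    ... | inj₂ refl = ¬pL

∣n! : ∀ {j n} → 1 ≤ j → j ≤ n → j ∣ n !
∣n! {suc i} _ j≤n = ∣-trans (m∣m*n (i !)) (m≤n⇒m!∣n! j≤n)

n≤n! : ∀ n → n ≤ n !
n≤n! 0       = z≤n
n≤n! (suc n) = ∣⇒≤ {{suc n !≢0}} (∣n! (s≤s z≤n) ≤-refl)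

-- The least divisor ≥ 2 of any number is prime: a smaller nontrivial
-- divisor of it would be a smaller divisor ≥ 2 of the number.
leastDivisorPrime : ∀ {N d} → FirstFrom (_∣ N) 2 d → Prime d
leastDivisorPrime {N} {d} first = rough∧∣⇒prime {{n>1⇒nonTrivial from}} rough holds
  where
  open FirstFrom first
  rough : d Rough N
  rough (hasNonTrivialDivisor {e} e<d e∣N) = before e (nonTrivial⇒n>1 e) e<d e∣N

-- Euclid: the least divisor ≥ 2 of L! + 1 is a prime, and it exceeds L
-- since every d ≤ L divides L!, so d ∣ 1.
primeAbove : ∀ L → ∃[ p ] (L ≤ p × Prime p)
primeAbove L with firstFrom (_∣? (L ! + 1)) (+-monoˡ-≤ 1 (1≤n! L)) ∣-refl
... | d , first = d , L≤d , leastDivisorPrime first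
  where
  open FirstFrom first
  L≤d : L ≤ d
  L≤d with d ≤? L
  ... | no  d≰L = <⇒≤ (≰⇒> d≰L)
  ... | yes d≤L = contradiction (∣1⇒≡1 (∣m+n∣m⇒∣n holds (∣n! (<⇒≤ from) d≤L))) (>⇒≢ from)

¬prime[m+d] : ∀ {m d} → 1 ≤ m → 2 ≤ d → d ∣ m → ¬ Prime (m + d)
¬prime[m+d] {m} {d} 1≤m 2≤d d∣m =
  composite⇒¬prime (hasNonTrivialDivisor {{n>1⇒nonTrivial 2≤d}} (+-monoˡ-≤ d 1≤m) (∣m∣n⇒∣m+n d∣m ∣-refl))

factorialRun : ∀ {M j} → 2 ≤ j → j ≤ M → ¬ Prime (M ! + j)
factorialRun {M} 2≤j j≤M = ¬prime[m+d] (1≤n! M) 2≤j (∣n! (<⇒≤ 2≤j) j≤M)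

primeBeyondRun : ∀ M {q} → M ! + 2 ≤ q → Prime q → M ! + suc M ≤ q
primeBeyondRun M {q} K+2≤q pq with m≤n⇒∃[o]m+o≡n (m+n≤o⇒m≤o (M !) K+2≤q)
... | j , refl with M <? j
...   | yes M<j = +-monoʳ-≤ (M !) M<j
...   | no  M≮j = contradiction pq (factorialRun (+-cancelˡ-≤ (M !) 2 j K+2≤q) (≮⇒≥ M≮j))

-- If n ≥ L and n + a is the first prime ≥ L, then a_n = a: each n + b with
-- 1 ≤ b < a lies in [L, n + a).
gapFromFirstPrime : ∀ {L n a} → 1 ≤ a → L ≤ n → FirstFrom Prime L (n + a) → IsLeastPrimeGap n a
gapFromFirstPrime {n = n} 1≤a L≤n first =
  1≤a , holds , λ b _ b<a → before (n + b) (≤-trans L≤n (m≤m+n n b)) (+-monoʳ-< n b<a)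
  where open FirstFrom first

proposition1 : ∀ (a : ℕ) → 1 ≤ a → ∀ (m : ℕ) → ∃[ n ] ((n ≥ m) × (n ≥ 1) × IsLeastPrimeGap n a)
proposition1 a 1≤a m with primeAbove (suc (m + a) ! + 2)
... | p , L≤p , pp with firstFrom prime? L≤p pp
... | q , first = q ∸ a , m≤n , ≤-trans (n≤1+n 1) (m+n≤o⇒n≤o K L≤n) , gapFromFirstPrime 1≤a L≤n first′
  where
  open FirstFrom first
  M = suc (m + a)
  K = M !
  -- q is past the composite run, hence at least (K + 2) + a.
  L+a≤q : K + 2 + a ≤ q
  L+a≤q = begin
    K + 2 + a    ≡⟨ +-assoc K 2 a ⟩
    K + (2 + a)  ≤⟨ +-monoʳ-≤ K (s≤s (s≤s (m≤n+m a m))) ⟩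
    K + suc M    ≤⟨ primeBeyondRun M from holds ⟩
    q            ∎
    where open ≤-Reasoning
  L≤n : K + 2 ≤ q ∸ a
  L≤n = m+n≤o⇒m≤o∸n (K + 2) L+a≤q
  m≤n : m ≤ q ∸ a
  m≤n = begin
    m            ≤⟨ ≤-trans (m≤m+n m a) (n≤1+n (m + a)) ⟩
    M            ≤⟨ n≤n! M ⟩
    K            ≤⟨ m+n≤o⇒m≤o K L≤n ⟩
    q ∸ a        ∎
    where open ≤-Reasoning
  first′ : FirstFrom Prime (K + 2) (q ∸ a + a)
  first′ = subst (FirstFrom Prime (K + 2)) (sym (m∸n+n≡m (m+n≤o⇒n≤o (K + 2) L+a≤q))) first
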